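{- The $k$-Path problem on $n$-vertex graphs can be solved by a deterministic one-pass streaming algorithm using $O(k\cdot n)$ space in insertion-only streams and $\widetilde{O}(k\cdot n)$ space in insertion-deletion streams.
   Context: $k$-Path: given an undirected graph $G$ on $n$ vertices, decide whether $G$ has a path of length at least $k$ (a path on at least $k+1$ vertices). Streaming model: the $n$ vertices are fixed, edges arrive one by one (insertion-only: only insertions; insertion-deletion: insertions and deletions). Space is measured in words of $O(\log n)$ bits; $\widetilde{O}$ hides $\log^{O(1)} n$ factors; unbounded computation is allowed. -}

module Defs where

open import Data.Nat using (ℕ; zero; suc; _+_; _*_; _^_; _≤_)
open import Data.Nat.Logarithm using (⌈log₂_⌉)
open import Data.Fin using (Fin; _≟_)
open import Data.Bool using (Bool; true; false; if_then_else_; _∧_; _∨_)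
open import Data.List using (List; []; _∷_; length; foldl; map)
open import Data.List.Relation.Unary.Unique.Propositional using (Unique)
open import Data.Product using (Σ; _×_; _,_)
open import Data.Unit using (⊤)
open import Relation.Nullary.Decidable using (⌊_⌋)
open import Relation.Binary.PropositionalEquality using (_≡_; _≢_)

-- An (undirected, simple) graph on vertex set Fin n, given by its
-- adjacency predicate; all graphs built below are symmetric and loopless.
Graph : ℕ → Set
Graph n = Fin n → Fin n → Bool

emptyGraph : ∀ {n} → Graph n
emptyGraph _ _ = false

setEdge : ∀ {n} → Bool → Fin n → Fin n → Graph n → Graph n
setEdge b u v G x y =
  if (⌊ x ≟ u ⌋ ∧ ⌊ y ≟ v ⌋) ∨ (⌊ x ≟ v ⌋ ∧ ⌊ y ≟ u ⌋) then b else G x y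

data Update (n : ℕ) : Set where
  ins : Fin n → Fin n → Update n
  del : Fin n → Fin n → Update n

applyUpdate : ∀ {n} → Graph n → Update n → Graph n
applyUpdate G (ins u v) = setEdge true u v G
applyUpdate G (del u v) = setEdge false u v G

streamGraph : ∀ {n} → List (Update n) → Graph n
streamGraph σ = foldl applyUpdate emptyGraph σ

ValidFrom : ∀ {n} → Graph n → List (Update n) → Set
ValidFrom G [] = ⊤
ValidFrom G (ins u v ∷ σ) = u ≢ v × G u v ≡ false × ValidFrom (setEdge true u v G) σ
ValidFrom G (del u v ∷ σ) = u ≢ v × G u v ≡ true × ValidFrom (setEdge false u v G) σ

ValidStream : ∀ {n} → List (Update n) → Set
ValidStream σ = ValidFrom emptyGraph σ

insStream : ∀ {n} → List (Fin n × Fin n) → List (Update n)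
insStream = map (λ { (u , v) → ins u v })

Walk : ∀ {n} → Graph n → List (Fin n) → Set
Walk G [] = ⊤
Walk G (x ∷ []) = ⊤
Walk G (x ∷ y ∷ r) = G x y ≡ true × Walk G (y ∷ r)

-- G has a path of length at least k (at least k+1 distinct vertices)
HasPathOfLength≥ : ∀ {n} → Graph n → ℕ → Set
HasPathOfLength≥ {n} G k =
  Σ (List (Fin n)) λ p → Unique p × Walk G p × suc k ≤ length p

-- A deterministic one-pass streaming algorithm over stream alphabet A
-- using s bits of memory: its memory states are Fin (2 ^ s); computation
-- per item is unbounded (arbitrary functions).
record StreamAlg (A : Set) (s : ℕ) : Set where
  field
    init : Fin (2 ^ s)
    step : Fin (2 ^ s) → A → Fin (2 ^ s)
    out  : Fin (2 ^ s) → Bool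

  run : List A → Fin (2 ^ s)
  run = foldl step init

-- number of bits in a machine word on n-vertex inputs (Θ(log n))
wordBits : ℕ → ℕ
wordBits n = suc ⌈log₂ n ⌉

DecidesPathIns : ∀ {n s} → ℕ → StreamAlg (Fin n × Fin n) s → Set
DecidesPathIns {n} k A =
  (σ : List (Fin n × Fin n)) → ValidStream (insStream σ) →
  (StreamAlg.out A (StreamAlg.run A σ) ≡ true → HasPathOfLength≥ (streamGraph (insStream σ)) k) ×
  (HasPathOfLength≥ (streamGraph (insStream σ)) k → StreamAlg.out A (StreamAlg.run A σ) ≡ true)

DecidesPathInsDel : ∀ {n s} → ℕ → StreamAlg (Update n) s → Set
DecidesPathInsDel {n} k A =
  (σ : List (Update n)) → ValidStream σ →
  (StreamAlg.out A (StreamAlg.run A σ) ≡ true → HasPathOfLength≥ (streamGraph σ) k) ×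
  (HasPathOfLength≥ (streamGraph σ) k → StreamAlg.out A (StreamAlg.run A σ) ≡ true)

module Submission where

-- A symmetric graph with no path of length k has at most 2k·n ordered
-- adjacent pairs (path-or-sparse: delete vertices of degree ≤ k; when none
-- is left, grow a k-path greedily).  The algorithm keeps two quantities
-- that an insertion or deletion updates by itself: the number of ordered
-- adjacent pairs, and the xor-sketch of the adjacency set under a code in
-- which no nonempty set of ≤ 4kn+1 codewords xors to zero (constructed
-- greedily, independent-code).  At the end a count above 2kn certifies a
-- k-path; otherwise the graph is sparse, hence determined by its sketch
-- (sketch-determines), and it is recovered by exhaustive search.
-- Codewords have O(k·n·log n) bits, so the state fits in 11·k·n words of
-- ⌈log₂ n⌉+1 bits; insertion-only streams are the special case of
-- insertions.

open import Defs
open import Data.Nat using (ℕ; _*_; _^_)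
open import Data.Fin using (Fin)
open import Data.Product using (Σ; _×_)

open import Level using (0ℓ)
open import Algebra.Bundles using (CommutativeMonoid)
open import Algebra.Structures using (IsCommutativeMonoid)
import Algebra.Properties.CommutativeMonoid.Sum as MonoidSum
open import Data.Bool using (Bool; true; false; if_then_else_; _xor_; _∨_; _∧_)
import Data.Bool.Properties as Bool
open import Data.Bool.Properties using (⇔→≡; ∨-comm; ∧-comm; ∨-zeroʳ; xor-assoc; xor-comm; xor-identityˡ; xor-identityʳ; xor-same)
open import Data.Empty using (⊥-elim)
import Data.Fin as Fin
open import Data.Fin using (zero; suc; _≟_; toℕ; fromℕ<; inject≤; punchIn; _↑ˡ_; _↑ʳ_; combine; remQuot)
open import Data.Fin.Properties using (toℕ-fromℕ<; toℕ-inject≤; toℕ<n; fromℕ<-cong; fromℕ<-toℕ; *↔×; 2↔Bool; punchInᵢ≢i; punchIn-injective; any?; remQuot-combine; combine-remQuot; combine-injective)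
open import Data.List using (List; []; _∷_; foldl; length; map; take; cartesianProductWith; allFin)
open import Data.List.Properties using (foldl-map; length-map; length-++; length-take; length-tabulate)
open import Data.List.Membership.Propositional using (_∈_; _∉_; lose; find)
open import Data.List.Membership.Propositional.Properties using (∈-map⁺; ∈-map⁻; ∈-cartesianProductWith⁺; ∈-cartesianProductWith⁻; ∈-allFin)
open import Data.List.Relation.Unary.All using (All)
import Data.List.Relation.Unary.All as All
open import Data.List.Relation.Unary.All.Properties using (¬Any⇒All¬)
open import Data.List.Relation.Unary.AllPairs using ([]; _∷_)
open import Data.List.Relation.Unary.Any using (Any; here; there; satisfied)
import Data.List.Relation.Unary.Any as Any
open import Data.List.Relation.Unary.Unique.Propositional using (Unique)
import Data.List.Relation.Unary.Unique.Propositional.Properties as Unique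
import Data.Nat as ℕ
open import Data.Nat using (zero; suc; _+_; _∸_; _≤_; _<_; z≤n; s≤s; _≤?_; _<?_; ⌈_/2⌉)
open import Data.Nat.Logarithm using (⌈log₂_⌉)
open import Data.Nat.Logarithm.Core using (⌈log2⌉)
open import Data.Nat.Properties hiding (_≟_)
open import Data.Nat.Tactic.RingSolver using (solve-∀)
open import Data.Product using (_,_; proj₁; proj₂)
open import Data.Product.Function.NonDependent.Propositional using (_×-↪_)
open import Data.Sum using (_⊎_; inj₁; inj₂)
import Data.Sum as Sum
open import Data.Unit using (tt)
open import Data.Vec using (Vec; []; _∷_; zipWith; replicate)
open import Data.Vec.Properties using (≡-dec; zipWith-assoc; zipWith-comm; zipWith-identityˡ; zipWith-identityʳ; zipWith-inverseˡ; map-id)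
open import Data.Vec.Functional using (Vector; updateAt)
open import Data.Vec.Functional.Properties using (updateAt-updates; updateAt-minimal)
open import Function using (_∘_; const; id)
open import Function.Bundles using (mk⇔; _↪_; mk↪; RightInverse)
open import Function.Construct.Composition using (_↪-∘_)
open import Function.Construct.Identity using (↪-id)
open import Function.Properties.Inverse using (↔⇒↪; ↔-sym)
open import Induction.WellFounded using (Acc; acc)
open import Relation.Binary.PropositionalEquality
  using (_≡_; _≢_; refl; sym; trans; cong; cong₂; subst; _≗_; isEquivalence; module ≡-Reasoning)
open import Relation.Nullary using (¬_)
open import Relation.Nullary.Decidable using (Dec; yes; no; map′; does; ⌊_⌋; _×-dec_; dec-true; dec-false; isYes≗does)

false≢true : false ≢ true
false≢true ()

infixl 20 _∖_

_∖_ : ∀ {N} → (Fin N → Bool) → Fin N → Fin N → Bool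
F ∖ i = updateAt F i (const false)

∖-same : ∀ {N} (F : Fin N → Bool) i → (F ∖ i) i ≡ false
∖-same F i = updateAt-updates i F

∖-other : ∀ {N} (F : Fin N → Bool) {i j} → j ≢ i → (F ∖ i) j ≡ F j
∖-other F {i} {j} = updateAt-minimal j i F

∖₂-agree : ∀ {N} (F F′ : Fin N → Bool) {i j} →
           (∀ l → l ≢ i → l ≢ j → F′ l ≡ F l) → F′ ∖ i ∖ j ≗ F ∖ i ∖ j
∖₂-agree F F′ {i} {j} agree l with l ≟ j | l ≟ i
... | yes refl | _ = trans (∖-same (F′ ∖ i) l) (sym (∖-same (F ∖ i) l))
... | no l≢j | yes refl = begin
  (F′ ∖ i ∖ j) l ≡⟨ ∖-other (F′ ∖ i) l≢j ⟩
  (F′ ∖ i) l     ≡⟨ ∖-same F′ l ⟩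
  false          ≡⟨ ∖-same F l ⟨
  (F ∖ i) l      ≡⟨ ∖-other (F ∖ i) l≢j ⟨
  (F ∖ i ∖ j) l  ∎
  where open ≡-Reasoning
... | no l≢j | no l≢i = begin
  (F′ ∖ i ∖ j) l ≡⟨ ∖-other (F′ ∖ i) l≢j ⟩
  (F′ ∖ i) l     ≡⟨ ∖-other F′ l≢i ⟩
  F′ l           ≡⟨ agree l l≢i l≢j ⟩
  F l            ≡⟨ ∖-other F l≢i ⟨
  (F ∖ i) l      ≡⟨ ∖-other (F ∖ i) l≢j ⟨
  (F ∖ i ∖ j) l  ∎
  where open ≡-Reasoning

record AddsPair {N} (F F′ : Fin N → Bool) (i j : Fin N) : Set where
  field
    distinct  : i ≢ j
    old-i     : F i ≡ false
    old-j     : F j ≡ false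
    new-i     : F′ i ≡ true
    new-j     : F′ j ≡ true
    elsewhere : ∀ l → l ≢ i → l ≢ j → F′ l ≡ F l

module FiniteSums {M : Set} {_∙_ : M → M → M} {ε : M}
                  (isCM : IsCommutativeMonoid _≡_ _∙_ ε) where

  private
    monoid : CommutativeMonoid 0ℓ 0ℓ
    monoid = record { isCommutativeMonoid = isCM }
    open IsCommutativeMonoid isCM using (identityˡ)

  open MonoidSum monoid public using (sum; sum-cong-≗; sum-remove; sum-replicate-zero; ∑-distrib-+)

  sum-point : ∀ {N} (t : Vector M N) i → sum t ≡ t i ∙ sum (updateAt t i (const ε))
  sum-point {suc N} t i = begin
      sum t                                   ≡⟨ sum-remove t ⟩
      t i ∙ sum (t ∘ punchIn i)               ≡⟨ cong (t i ∙_) rest ⟩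
      t i ∙ sum (updateAt t i (const ε))      ∎
    where
    open ≡-Reasoning
    t′ = updateAt t i (const ε)
    rest : sum (t ∘ punchIn i) ≡ sum t′
    rest = sym (begin
      sum t′                         ≡⟨ sum-remove t′ ⟩
      t′ i ∙ sum (t′ ∘ punchIn i)    ≡⟨ cong₂ _∙_ (updateAt-updates i t)
                                          (sum-cong-≗ (λ j → updateAt-minimal (punchIn i j) i t (punchInᵢ≢i i j))) ⟩
      ε ∙ sum (t ∘ punchIn i)        ≡⟨ identityˡ _ ⟩
      sum (t ∘ punchIn i)            ∎)

  sum-↑ : ∀ m n (t : Vector M (m + n)) → sum t ≡ sum (t ∘ (_↑ˡ n)) ∙ sum (t ∘ (m ↑ʳ_))
  sum-↑ zero n t = sym (identityˡ _)
  sum-↑ (suc m) n t = trans (cong (t zero ∙_) (sum-↑ m n (t ∘ suc))) (sym (IsCommutativeMonoid.assoc isCM _ _ _))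

  sum-combine : ∀ m n (t : Vector M (m * n)) →
                sum t ≡ sum {m} (λ x → sum {n} (λ y → t (combine x y)))
  sum-combine zero n t = refl
  sum-combine (suc m) n t =
    trans (sum-↑ n (m * n) t) (cong (sum {n} (t ∘ (_↑ˡ m * n)) ∙_) (sum-combine m n (t ∘ (n ↑ʳ_))))

  mask : ∀ {N} → (Fin N → Bool) → Vector M N → Vector M N
  mask F t i = if F i then t i else ε

  mask-∖ : ∀ {N} (F : Fin N → Bool) t i → mask (F ∖ i) t ≗ updateAt (mask F t) i (const ε)
  mask-∖ F t i j with j ≟ i
  ... | yes refl = trans (cong (λ b → if b then t i else ε) (∖-same F i)) (sym (updateAt-updates i (mask F t)))
  ... | no j≢i = trans (cong (λ b → if b then t j else ε) (∖-other F j≢i)) (sym (updateAt-minimal j i (mask F t) j≢i))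

  mask-point : ∀ {N} (F : Fin N → Bool) t i → sum (mask F t) ≡ mask F t i ∙ sum (mask (F ∖ i) t)
  mask-point F t i = trans (sum-point (mask F t) i) (cong (mask F t i ∙_) (sym (sum-cong-≗ (mask-∖ F t i))))

  mask-insert₂ : ∀ {N} {F F′ : Fin N → Bool} {i j} → AddsPair F F′ i j →
                 ∀ t → sum (mask F′ t) ≡ t i ∙ (t j ∙ sum (mask F t))
  mask-insert₂ {F = F} {F′} {i} {j} adds t = begin
      sum (mask F′ t)                                          ≡⟨ pull F′ ⟩
      mask F′ t i ∙ (mask (F′ ∖ i) t j ∙ sum (mask (F′ ∖ i ∖ j) t))
        ≡⟨ cong₂ (λ a b → a ∙ (b ∙ sum (mask (F′ ∖ i ∖ j) t))) (in-mask F′ F′i) (in-mask (F′ ∖ i) (trans (∖-other F′ j≢i) F′j)) ⟩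
      t i ∙ (t j ∙ sum (mask (F′ ∖ i ∖ j) t))                  ≡⟨ cong (λ z → t i ∙ (t j ∙ z)) (sum-cong-≗ same-rest) ⟩
      t i ∙ (t j ∙ sum (mask (F ∖ i ∖ j) t))                   ≡⟨ cong (λ z → t i ∙ (t j ∙ z)) (sym F-rest) ⟩
      t i ∙ (t j ∙ sum (mask F t))                             ∎
    where
    open ≡-Reasoning
    open AddsPair adds renaming (old-i to Fi; old-j to Fj; new-i to F′i; new-j to F′j; elsewhere to agree)
    j≢i : j ≢ i
    j≢i = distinct ∘ sym
    pull : ∀ G → sum (mask G t) ≡ mask G t i ∙ (mask (G ∖ i) t j ∙ sum (mask (G ∖ i ∖ j) t))
    pull G = trans (mask-point G t i) (cong (mask G t i ∙_) (mask-point (G ∖ i) t j))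
    in-mask : ∀ G {l} → G l ≡ true → mask G t l ≡ t l
    in-mask G {l} = cong (λ b → if b then t l else ε)
    out-mask : ∀ G {l} → G l ≡ false → mask G t l ≡ ε
    out-mask G {l} = cong (λ b → if b then t l else ε)
    F-rest : sum (mask F t) ≡ sum (mask (F ∖ i ∖ j) t)
    F-rest = begin
      sum (mask F t)                                               ≡⟨ pull F ⟩
      mask F t i ∙ (mask (F ∖ i) t j ∙ sum (mask (F ∖ i ∖ j) t))
        ≡⟨ cong₂ (λ a b → a ∙ (b ∙ sum (mask (F ∖ i ∖ j) t))) (out-mask F Fi) (out-mask (F ∖ i) (trans (∖-other F j≢i) Fj)) ⟩
      ε ∙ (ε ∙ sum (mask (F ∖ i ∖ j) t))                           ≡⟨ trans (identityˡ _) (identityˡ _) ⟩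
      sum (mask (F ∖ i ∖ j) t)                                     ∎
    same-rest : mask (F′ ∖ i ∖ j) t ≗ mask (F ∖ i ∖ j) t
    same-rest l = cong (λ b → if b then t l else ε) (∖₂-agree F F′ agree l)

module ℕΣ = FiniteSums +-0-isCommutativeMonoid

size : ∀ {N} → (Fin N → Bool) → ℕ
size F = ℕΣ.sum (ℕΣ.mask F (const 1))

ℕΣ-mono : ∀ {N} (f g : Fin N → ℕ) → (∀ i → f i ≤ g i) → ℕΣ.sum f ≤ ℕΣ.sum g
ℕΣ-mono {zero} f g f≤g = z≤n
ℕΣ-mono {suc N} f g f≤g = +-mono-≤ (f≤g zero) (ℕΣ-mono (f ∘ suc) (g ∘ suc) (f≤g ∘ suc))

size≤ : ∀ {N} (F : Fin N → Bool) → size F ≤ N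
size≤ {zero} F = z≤n
size≤ {suc N} F with F zero
... | true = s≤s (size≤ (F ∘ suc))
... | false = m≤n⇒m≤1+n (size≤ (F ∘ suc))

size-∖ : ∀ {N} (F : Fin N → Bool) i → size F ≤ suc (size (F ∖ i)) × size (F ∖ i) ≤ size F
size-∖ F i = bound (F i) (ℕΣ.mask-point F (const 1) i)
  where
  bound : ∀ b → size F ≡ (if b then 1 else 0) + size (F ∖ i) →
          size F ≤ suc (size (F ∖ i)) × size (F ∖ i) ≤ size F
  bound true split = ≤-reflexive split , ≤-trans (n≤1+n _) (≤-reflexive (sym split))
  bound false split = ≤-trans (≤-reflexive split) (n≤1+n _) , ≤-reflexive (sym split)

size-xor : ∀ {N} (F H : Fin N → Bool) → size (λ i → F i xor H i) ≤ size F + size H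
size-xor F H = ≤-trans (ℕΣ-mono _ _ (λ i → pointwise (F i) (H i)))
                       (≤-reflexive (ℕΣ.∑-distrib-+ (ℕΣ.mask F (const 1)) (ℕΣ.mask H (const 1))))
  where
  pointwise : ∀ a b → (if a xor b then 1 else 0) ≤ (if a then 1 else 0) + (if b then 1 else 0)
  pointwise false b = ≤-refl
  pointwise true false = ≤-refl
  pointwise true true = z≤n

nonempty : ∀ {N} (F : Fin N → Bool) → 0 < size F → Σ (Fin N) λ i → F i ≡ true
nonempty {suc N} F pos with F zero in F0
... | true = zero , F0
... | false = let (i , Fi) = nonempty (F ∘ suc) pos in suc i , Fi

BV : ℕ → Set
BV s = Vec Bool s

infixr 6 _⊕_

_⊕_ : ∀ {s} → BV s → BV s → BV s
_⊕_ = zipWith _xor_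

𝟘 : ∀ {s} → BV s
𝟘 = replicate _ false

module _ {s : ℕ} where

  ⊕-assoc : (u v w : BV s) → (u ⊕ v) ⊕ w ≡ u ⊕ (v ⊕ w)
  ⊕-assoc = zipWith-assoc xor-assoc

  ⊕-comm : (u v : BV s) → u ⊕ v ≡ v ⊕ u
  ⊕-comm = zipWith-comm xor-comm

  ⊕-identityˡ : (v : BV s) → 𝟘 ⊕ v ≡ v
  ⊕-identityˡ = zipWith-identityˡ xor-identityˡ

  ⊕-identityʳ : (v : BV s) → v ⊕ 𝟘 ≡ v
  ⊕-identityʳ = zipWith-identityʳ xor-identityʳ

  ⊕-self : (v : BV s) → v ⊕ v ≡ 𝟘
  ⊕-self v = trans (cong (_⊕ v) (sym (map-id v))) (zipWith-inverseˡ xor-same v)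

  ⊕-isCommutativeMonoid : IsCommutativeMonoid _≡_ _⊕_ 𝟘
  ⊕-isCommutativeMonoid = record
    { isMonoid = record
      { isSemigroup = record
        { isMagma = record { isEquivalence = isEquivalence ; ∙-cong = cong₂ _⊕_ }
        ; assoc = ⊕-assoc }
      ; identity = ⊕-identityˡ , ⊕-identityʳ }
    ; comm = ⊕-comm }

  ⊕-cancelˡ : (a x : BV s) → a ⊕ (a ⊕ x) ≡ x
  ⊕-cancelˡ a x = begin
    a ⊕ (a ⊕ x)   ≡⟨ ⊕-assoc a a x ⟨
    (a ⊕ a) ⊕ x   ≡⟨ cong (_⊕ x) (⊕-self a) ⟩
    𝟘 ⊕ x         ≡⟨ ⊕-identityˡ x ⟩
    x             ∎
    where open ≡-Reasoning

  ⊕-cancel : (v w : BV s) → v ⊕ w ≡ 𝟘 → v ≡ w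
  ⊕-cancel v w e = sym (trans (sym (⊕-cancelˡ v w)) (trans (cong (v ⊕_) e) (⊕-identityʳ v)))

  ⊕-swap : (a b x : BV s) → a ⊕ (b ⊕ x) ≡ b ⊕ (a ⊕ x)
  ⊕-swap a b x = begin
    a ⊕ (b ⊕ x)   ≡⟨ ⊕-assoc a b x ⟨
    (a ⊕ b) ⊕ x   ≡⟨ cong (_⊕ x) (⊕-comm a b) ⟩
    (b ⊕ a) ⊕ x   ≡⟨ ⊕-assoc b a x ⟩
    b ⊕ (a ⊕ x)   ∎
    where open ≡-Reasoning

module ⊕Σ {s : ℕ} = FiniteSums (⊕-isCommutativeMonoid {s})

sketch : ∀ {N s} → (Fin N → BV s) → (Fin N → Bool) → BV s
sketch c F = ⊕Σ.sum (⊕Σ.mask F c)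

sketch-xor : ∀ {N s} (c : Fin N → BV s) F H → sketch c (λ i → F i xor H i) ≡ sketch c F ⊕ sketch c H
sketch-xor c F H = trans (⊕Σ.sum-cong-≗ (λ i → pointwise (F i) (H i) (c i)))
                         (⊕Σ.∑-distrib-+ (⊕Σ.mask F c) (⊕Σ.mask H c))
  where
  pointwise : ∀ a b v → (if a xor b then v else 𝟘) ≡ (if a then v else 𝟘) ⊕ (if b then v else 𝟘)
  pointwise false b v = sym (⊕-identityˡ _)
  pointwise true false v = sym (⊕-identityʳ v)
  pointwise true true v = sym (⊕-self v)

Sym : ∀ {n} → Graph n → Set
Sym G = ∀ x y → G x y ≡ G y x

setEdge-sym : ∀ {n} b (u v : Fin n) G → Sym G → Sym (setEdge b u v G)
setEdge-sym b u v G sym-G x y =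
  cong₂ (λ c g → if c then b else g) (swap-condition ⌊ x ≟ u ⌋ ⌊ y ≟ v ⌋ ⌊ x ≟ v ⌋ ⌊ y ≟ u ⌋) (sym-G x y)
  where
  swap-condition : ∀ a b c d → (a ∧ b) ∨ (c ∧ d) ≡ (d ∧ c) ∨ (b ∧ a)
  swap-condition a b c d = trans (∨-comm (a ∧ b) (c ∧ d)) (cong₂ _∨_ (∧-comm c d) (∧-comm a b))

streamGraph-sym : ∀ {n} (σ : List (Update n)) → Sym (streamGraph σ)
streamGraph-sym = go emptyGraph (λ _ _ → refl)
  where
  go : ∀ {n} (G : Graph n) → Sym G → ∀ σ → Sym (foldl applyUpdate G σ)
  go G sym-G [] = sym-G
  go G sym-G (ins u v ∷ σ) = go _ (setEdge-sym true u v G sym-G) σ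
  go G sym-G (del u v ∷ σ) = go _ (setEdge-sym false u v G sym-G) σ

⌊⌋-∧ : ∀ {P Q : Set} (a : Dec P) (b : Dec Q) → ⌊ a ⌋ ∧ ⌊ b ⌋ ≡ does (a ×-dec b)
⌊⌋-∧ a b = cong₂ _∧_ (isYes≗does a) (isYes≗does b)

setEdge-at : ∀ {n} b (u v : Fin n) G → setEdge b u v G u v ≡ b
setEdge-at b u v G =
  cong (λ c → if c ∨ (⌊ u ≟ v ⌋ ∧ ⌊ v ≟ u ⌋) then b else G u v)
       (trans (⌊⌋-∧ (u ≟ u) (v ≟ v)) (dec-true (u ≟ u ×-dec v ≟ v) (refl , refl)))

setEdge-at′ : ∀ {n} b (u v : Fin n) G → setEdge b u v G v u ≡ b
setEdge-at′ b u v G =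
  cong (λ c → if c then b else G v u)
       (trans (cong (⌊ v ≟ u ⌋ ∧ ⌊ u ≟ v ⌋ ∨_)
                    (trans (⌊⌋-∧ (v ≟ v) (u ≟ u)) (dec-true (v ≟ v ×-dec u ≟ u) (refl , refl))))
              (∨-zeroʳ (⌊ v ≟ u ⌋ ∧ ⌊ u ≟ v ⌋)))

setEdge-other : ∀ {n} b (u v : Fin n) G x y → ¬ (x ≡ u × y ≡ v) → ¬ (x ≡ v × y ≡ u) →
                setEdge b u v G x y ≡ G x y
setEdge-other b u v G x y not-uv not-vu =
  cong₂ (λ c d → if c ∨ d then b else G x y)
        (trans (⌊⌋-∧ (x ≟ u) (y ≟ v)) (dec-false (x ≟ u ×-dec y ≟ v) not-uv))
        (trans (⌊⌋-∧ (x ≟ v) (y ≟ u)) (dec-false (x ≟ v ×-dec y ≟ u) not-vu))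

flat : ∀ {n} → Graph n → Fin (n * n) → Bool
flat {n} G l = G (proj₁ (remQuot {n} n l)) (proj₂ (remQuot {n} n l))

flat-combine : ∀ {n} (G : Graph n) x y → flat G (combine x y) ≡ G x y
flat-combine {n} G x y = cong (λ p → G (proj₁ p) (proj₂ p)) (remQuot-combine {n} {n} x y)

setEdge-flat-other : ∀ {n} b (u v : Fin n) G l → l ≢ combine u v → l ≢ combine v u →
                     flat (setEdge b u v G) l ≡ flat G l
setEdge-flat-other {n} b u v G l l≢uv l≢vu =
  setEdge-other b u v G x y (λ (x≡u , y≡v) → l≢uv (as-pair x≡u y≡v)) (λ (x≡v , y≡u) → l≢vu (as-pair x≡v y≡u))
  where
  x = proj₁ (remQuot {n} n l)
  y = proj₂ (remQuot {n} n l)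
  as-pair : ∀ {a b} → x ≡ a → y ≡ b → l ≡ combine a b
  as-pair refl refl = sym (combine-remQuot {n} n l)

module _ {n} {u v : Fin n} {G : Graph n} (u≢v : u ≢ v) (sym-G : Sym G) where
  private
    distinct : combine u v ≢ combine v u
    distinct e = u≢v (proj₁ (combine-injective u v v u e))
    old : ∀ {a} → G u v ≡ a → flat G (combine u v) ≡ a × flat G (combine v u) ≡ a
    old e = trans (flat-combine G u v) e , trans (flat-combine G v u) (trans (sym-G v u) e)
    new : ∀ b → flat (setEdge b u v G) (combine u v) ≡ b × flat (setEdge b u v G) (combine v u) ≡ b
    new b = trans (flat-combine (setEdge b u v G) u v) (setEdge-at b u v G)
          , trans (flat-combine (setEdge b u v G) v u) (setEdge-at′ b u v G)

  insertion-adds : G u v ≡ false → AddsPair (flat G) (flat (setEdge true u v G)) (combine u v) (combine v u)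
  insertion-adds absent = record
    { distinct = distinct ; old-i = proj₁ (old absent) ; old-j = proj₂ (old absent)
    ; new-i = proj₁ (new true) ; new-j = proj₂ (new true)
    ; elsewhere = setEdge-flat-other true u v G }

  deletion-removes : G u v ≡ true → AddsPair (flat (setEdge false u v G)) (flat G) (combine u v) (combine v u)
  deletion-removes present = record
    { distinct = distinct ; old-i = proj₁ (new false) ; old-j = proj₂ (new false)
    ; new-i = proj₁ (old present) ; new-j = proj₂ (old present)
    ; elsewhere = λ l l≢i l≢j → sym (setEdge-flat-other false u v G l l≢i l≢j) }

path-cong : ∀ {n} {G H : Graph n} {k} → (∀ x y → G x y ≡ H x y) → HasPathOfLength≥ G k → HasPathOfLength≥ H k
path-cong {G = G} {H} G≡H (p , unique , walk , long) = p , unique , walk-cong p walk , long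
  where
  walk-cong : ∀ p → Walk G p → Walk H p
  walk-cong [] _ = tt
  walk-cong (x ∷ []) _ = tt
  walk-cong (x ∷ y ∷ p) (edge , walk) = trans (sym (G≡H x y)) edge , walk-cong (y ∷ p) walk

-- Degrees, and the number of ordered adjacent pairs (twice the number of
-- edges of a loopless symmetric graph).
deg : ∀ {n} → Graph n → Fin n → ℕ
deg G x = size (G x)

edgeCount : ∀ {n} → Graph n → ℕ
edgeCount G = ℕΣ.sum (deg G)

edgeCount-flat : ∀ {n} (G : Graph n) → edgeCount G ≡ size (flat G)
edgeCount-flat {n} G = sym (trans (ℕΣ.sum-combine n n _)
  (ℕΣ.sum-cong-≗ (λ x → ℕΣ.sum-cong-≗ (λ y → cong (λ b → if b then 1 else 0) (flat-combine G x y)))))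

fresh-element : ∀ {N} (P : Fin N → Bool) (p : List (Fin N)) → length p < size P →
                Σ (Fin N) λ y → P y ≡ true × y ∉ p
fresh-element P [] pos = let (y , Py) = nonempty P pos in y , Py , λ ()
fresh-element P (a ∷ p) longer with fresh-element (P ∖ a) p (≤-pred (≤-trans longer (proj₁ (size-∖ P a))))
... | y , P∖a-y , y∉p = y , trans (sym (∖-other P y≢a)) P∖a-y , λ { (here y≡a) → y≢a y≡a ; (there y∈p) → y∉p y∈p }
  where
  y≢a : y ≢ a
  y≢a refl = false≢true (trans (sym (∖-same P y)) P∖a-y)

-- In a symmetric graph of minimum degree > k a path of length k is found
-- greedily: a path on at most k vertices can always be extended at its
-- end by a neighbour not yet on it.
module _ {n} (G : Graph n) (k : ℕ) (sym-G : Sym G) (high : ∀ v → k < deg G v) where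

  -- a path on m+1 vertices, listed from its end vertex v
  greedy : ∀ m → m ≤ k → Fin n →
           Σ (Fin n) λ v → Σ (List (Fin n)) λ rest → Unique (v ∷ rest) × Walk G (v ∷ rest) × length rest ≡ m
  greedy zero _ v₀ = v₀ , [] , (All.[] ∷ []) , tt , refl
  greedy (suc m) m<k v₀ with greedy m (≤-trans (n≤1+n m) m<k) v₀
  ... | v , rest , unique , walk , len with fresh-element (G v) (v ∷ rest) short
    where
    short : length (v ∷ rest) < deg G v
    short = ≤-trans (s≤s (≤-trans (s≤s (≤-reflexive len)) m<k)) (high v)
  ... | y , Gvy , y∉ = y , v ∷ rest , (¬Any⇒All¬ _ y∉ ∷ unique) , (trans (sym-G y v) Gvy , walk) , cong suc len

  min-degree-path : Fin n → HasPathOfLength≥ G k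
  min-degree-path v₀ with greedy k ≤-refl v₀
  ... | v , rest , unique , walk , len = v ∷ rest , unique , walk , s≤s (≤-reflexive (sym len))

_−_ : ∀ {n} → Graph (suc n) → Fin (suc n) → Graph n
(G − v) x y = G (punchIn v x) (punchIn v y)

−-sym : ∀ {n} (G : Graph (suc n)) v → Sym G → Sym (G − v)
−-sym G v sym-G x y = sym-G (punchIn v x) (punchIn v y)

edgeCount-delete : ∀ {n} (G : Graph (suc n)) v → Sym G → edgeCount G ≤ edgeCount (G − v) + 2 * deg G v
edgeCount-delete G v sym-G = begin
  edgeCount G                                         ≡⟨ ℕΣ.sum-remove {i = v} (deg G) ⟩
  deg G v + ℕΣ.sum (deg G ∘ punchIn v)
    ≡⟨ cong (deg G v +_) (ℕΣ.sum-cong-≗ (λ x → ℕΣ.sum-remove {i = v} (ℕΣ.mask (G (punchIn v x)) (const 1)))) ⟩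
  deg G v + ℕΣ.sum (λ x → into-v x + deg (G − v) x)   ≡⟨ cong (deg G v +_) (ℕΣ.∑-distrib-+ into-v (deg (G − v))) ⟩
  deg G v + (ℕΣ.sum into-v + edgeCount (G − v))       ≤⟨ +-monoʳ-≤ (deg G v) (+-monoˡ-≤ (edgeCount (G − v)) into-v≤deg) ⟩
  deg G v + (deg G v + edgeCount (G − v))             ≡⟨ rearrange (deg G v) (edgeCount (G − v)) ⟩
  edgeCount (G − v) + 2 * deg G v                     ∎
  where
  open ≤-Reasoning
  rearrange : ∀ d e → d + (d + e) ≡ e + 2 * d
  rearrange = solve-∀
  into-v : Fin _ → ℕ
  into-v x = if G (punchIn v x) v then 1 else 0
  into-v≤deg : ℕΣ.sum into-v ≤ deg G v
  into-v≤deg = begin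
    ℕΣ.sum into-v
      ≡⟨ ℕΣ.sum-cong-≗ (λ x → cong (λ b → if b then 1 else 0) (sym-G (punchIn v x) v)) ⟩
    ℕΣ.sum (ℕΣ.mask (G v) (const 1) ∘ punchIn v)      ≤⟨ m≤n+m _ _ ⟩
    ℕΣ.mask (G v) (const 1) v + ℕΣ.sum (ℕΣ.mask (G v) (const 1) ∘ punchIn v)
      ≡⟨ ℕΣ.sum-remove {i = v} (ℕΣ.mask (G v) (const 1)) ⟨
    deg G v                                           ∎

path-lift : ∀ {n} (G : Graph (suc n)) v k → HasPathOfLength≥ (G − v) k → HasPathOfLength≥ G k
path-lift G v k (p , unique , walk , long) =
  map (punchIn v) p , Unique.map⁺ (punchIn-injective v _ _) unique , walk-lift p walk ,
  ≤-trans long (≤-reflexive (sym (length-map (punchIn v) p)))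
  where
  walk-lift : ∀ p → Walk (G − v) p → Walk G (map (punchIn v) p)
  walk-lift [] _ = tt
  walk-lift (x ∷ []) _ = tt
  walk-lift (x ∷ y ∷ p) (edge , walk) = edge , walk-lift (y ∷ p) walk

-- Delete a
-- vertex of degree ≤ k if there is one; otherwise grow a path greedily.
path-or-sparse : ∀ {n} (G : Graph n) k → Sym G → HasPathOfLength≥ G k ⊎ edgeCount G ≤ n * (2 * k)
path-or-sparse {zero} G k sym-G = inj₂ z≤n
path-or-sparse {suc n} G k sym-G with any? (λ v → deg G v ≤? k)
... | yes (v , low) = Sum.map (path-lift G v k) sparse (path-or-sparse (G − v) k (−-sym G v sym-G))
  where
  sparse : edgeCount (G − v) ≤ n * (2 * k) → edgeCount G ≤ suc n * (2 * k)
  sparse rest = ≤-trans (edgeCount-delete G v sym-G)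
                        (≤-trans (+-mono-≤ rest (*-monoʳ-≤ 2 low)) (≤-reflexive (+-comm (n * (2 * k)) (2 * k))))
... | no no-low = inj₁ (min-degree-path G k sym-G (λ v → ≰⇒> (λ low → no-low (v , low))) zero)

setOf : ∀ {N} → List (Fin N) → Fin N → Bool
setOf [] i = false
setOf (j ∷ l) i = ⌊ i ≟ j ⌋ ∨ setOf l i

trues : ∀ {N} → (Fin N → Bool) → List (Fin N)
trues {zero} F = []
trues {suc N} F = if F zero then zero ∷ rest else rest
  where rest = map suc (trues (F ∘ suc))

size-cong : ∀ {N} {F H : Fin N → Bool} → F ≗ H → size F ≡ size H
size-cong F≗H = ℕΣ.sum-cong-≗ (λ i → cong (λ b → if b then 1 else 0) (F≗H i))

size-setOf : ∀ {N} (l : List (Fin N)) → size (setOf l) ≤ length l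
size-setOf {N} [] = ≤-reflexive (ℕΣ.sum-replicate-zero N)
size-setOf (j ∷ l) = begin
  size (setOf (j ∷ l))          ≤⟨ proj₁ (size-∖ (setOf (j ∷ l)) j) ⟩
  suc (size (setOf (j ∷ l) ∖ j)) ≡⟨ cong suc (size-cong same-off-j) ⟩
  suc (size (setOf l ∖ j))       ≤⟨ s≤s (proj₂ (size-∖ (setOf l) j)) ⟩
  suc (size (setOf l))           ≤⟨ s≤s (size-setOf l) ⟩
  suc (length l)                 ∎
  where
  open ≤-Reasoning
  same-off-j : setOf (j ∷ l) ∖ j ≗ setOf l ∖ j
  same-off-j i with i ≟ j
  ... | yes refl = trans (∖-same (setOf (j ∷ l)) i) (sym (∖-same (setOf l) i))
  ... | no i≢j = trans (∖-other (setOf (j ∷ l)) i≢j)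
                       (trans (cong (_∨ setOf l i) (trans (isYes≗does (i ≟ j)) (dec-false (i ≟ j) i≢j)))
                              (sym (∖-other (setOf l) i≢j)))

setOf-∈ : ∀ {N} (l : List (Fin N)) i → setOf l i ≡ true → i ∈ l
setOf-∈ (j ∷ l) i i∈ with i ≟ j
... | yes refl = here refl
... | no _ = there (setOf-∈ l i i∈)

∈-setOf : ∀ {N} {l : List (Fin N)} {i} → i ∈ l → setOf l i ≡ true
∈-setOf {i = i} (here refl) with i ≟ i
... | yes _ = refl
... | no i≢i = ⊥-elim (i≢i refl)
∈-setOf {l = j ∷ l} {i} (there i∈l) = trans (cong (⌊ i ≟ j ⌋ ∨_) (∈-setOf i∈l)) (∨-zeroʳ _)

private
  ∈-map-suc⁻ : ∀ {N} {i : Fin N} {l} → suc i ∈ map suc l → i ∈ l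
  ∈-map-suc⁻ {N} m with ∈-map⁻ (Fin.suc {N}) m
  ... | x , x∈l , refl = x∈l

  zero∉map-suc : ∀ {N} {l : List (Fin N)} → zero ∉ map suc l
  zero∉map-suc {N} m with ∈-map⁻ (Fin.suc {N}) m
  ... | _ , _ , ()

∈-trues : ∀ {N} (F : Fin N → Bool) i → F i ≡ true → i ∈ trues F
∈-trues {suc N} F i Fi with F zero in F0 | i
... | true | zero = here refl
... | false | zero = ⊥-elim (false≢true (trans (sym F0) Fi))
... | true | suc i′ = there (∈-map⁺ suc (∈-trues (F ∘ suc) i′ Fi))
... | false | suc i′ = ∈-map⁺ suc (∈-trues (F ∘ suc) i′ Fi)

trues-∈ : ∀ {N} (F : Fin N → Bool) i → i ∈ trues F → F i ≡ true
trues-∈ {suc N} F i i∈ with F zero in F0 | i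
... | true | zero = F0
... | false | zero = ⊥-elim (zero∉map-suc i∈)
... | true | suc i′ = trues-∈ (F ∘ suc) i′ (∈-map-suc⁻ (tail-member i∈))
  where
  tail-member : ∀ {l} → suc i′ ∈ zero ∷ l → suc i′ ∈ l
  tail-member (there m) = m
... | false | suc i′ = trues-∈ (F ∘ suc) i′ (∈-map-suc⁻ i∈)

setOf-trues : ∀ {N} (F : Fin N → Bool) → setOf (trues F) ≗ F
setOf-trues F i = ⇔→≡ (mk⇔ (λ e → trues-∈ F i (setOf-∈ (trues F) i e)) (λ e → ∈-setOf (∈-trues F i e)))

length-trues : ∀ {N} (F : Fin N → Bool) → length (trues F) ≡ size F
length-trues {zero} F = refl
length-trues {suc N} F with F zero
... | true = cong suc (trans (length-map suc (trues (F ∘ suc))) (length-trues (F ∘ suc)))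
... | false = trans (length-map suc (trues (F ∘ suc))) (length-trues (F ∘ suc))

module _ {A : Set} where

  shortLists : List A → ℕ → List (List A)
  shortLists al zero = [] ∷ []
  shortLists al (suc r) = [] ∷ cartesianProductWith _∷_ al (shortLists al r)

  length-cartesianProductWith : ∀ {B C : Set} (f : A → B → C) xs ys →
                                length (cartesianProductWith f xs ys) ≡ length xs * length ys
  length-cartesianProductWith f [] ys = refl
  length-cartesianProductWith f (x ∷ xs) ys =
    trans (length-++ (map (f x) ys)) (cong₂ _+_ (length-map (f x) ys) (length-cartesianProductWith f xs ys))

  length-shortLists : ∀ al r → length (shortLists al r) ≤ suc (length al) ^ r
  length-shortLists al zero = ≤-refl
  length-shortLists al (suc r) = begin
    suc (length (cartesianProductWith _∷_ al (shortLists al r)))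
      ≡⟨ cong suc (length-cartesianProductWith _∷_ al (shortLists al r)) ⟩
    suc (length al * length (shortLists al r))   ≤⟨ s≤s (*-monoʳ-≤ (length al) (length-shortLists al r)) ⟩
    suc (length al * P)                           ≤⟨ +-monoˡ-≤ (length al * P) (m^n>0 (suc (length al)) r) ⟩
    P + length al * P                             ∎
    where
    open ≤-Reasoning
    P = suc (length al) ^ r

  ∈-shortLists : ∀ al r (l : List A) → All (_∈ al) l → length l ≤ r → l ∈ shortLists al r
  ∈-shortLists al zero [] _ _ = here refl
  ∈-shortLists al (suc r) [] _ _ = here refl
  ∈-shortLists al (suc r) (a ∷ l) (a∈ All.∷ l⊆) (s≤s len) =
    there (∈-cartesianProductWith⁺ _∷_ a∈ (∈-shortLists al r l l⊆ len))

  shortLists-length : ∀ al r {l : List A} → l ∈ shortLists al r → length l ≤ r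
  shortLists-length al zero (here refl) = z≤n
  shortLists-length al (suc r) (here refl) = z≤n
  shortLists-length al (suc r) (there m) with ∈-cartesianProductWith⁻ _∷_ al (shortLists al r) m
  ... | _ , l , _ , l∈ , refl = s≤s (shortLists-length al r l∈)

all-allFin : ∀ {N} (l : List (Fin N)) → All (_∈ allFin N) l
all-allFin l = All.tabulate (λ {i} _ → ∈-allFin i)

-- k-Path is decidable on a fixed graph: a path of length ≥ k may be cut
-- to exactly k+1 vertices, and those vertex lists can be enumerated.
walk? : ∀ {n} (G : Graph n) p → Dec (Walk G p)
walk? G [] = yes tt
walk? G (x ∷ []) = yes tt
walk? G (x ∷ y ∷ p) = (G x y Bool.≟ true) ×-dec walk? G (y ∷ p)

walk-take : ∀ {n} (G : Graph n) m p → Walk G p → Walk G (take m p)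
walk-take G zero p _ = tt
walk-take G (suc m) [] _ = tt
walk-take G (suc zero) (x ∷ p) _ = tt
walk-take G (suc (suc m)) (x ∷ []) _ = tt
walk-take G (suc (suc m)) (x ∷ y ∷ p) (edge , walk) = edge , walk-take G (suc m) (y ∷ p) walk

hasPath? : ∀ {n} (G : Graph n) k → Dec (HasPathOfLength≥ G k)
hasPath? {n} G k = map′ satisfied shorten (Any.any? isPath? (shortLists (allFin n) (suc k)))
  where
  IsPath : List (Fin n) → Set
  IsPath p = Unique p × Walk G p × suc k ≤ length p
  isPath? : ∀ p → Dec (IsPath p)
  isPath? p = unique? p ×-dec walk? G p ×-dec suc k ≤? length p
    where open import Data.List.Relation.Unary.Unique.DecPropositional (_≟_ {n}) using (unique?)
  shorten : HasPathOfLength≥ G k → Any IsPath (shortLists (allFin n) (suc k))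
  shorten (p , unique , walk , long) =
    lose (∈-shortLists (allFin n) (suc k) (take (suc k) p) (all-allFin _) (≤-reflexive exact))
         (Unique.take⁺ (suc k) unique , walk-take G (suc k) p walk , ≤-reflexive (sym exact))
    where
    exact : length (take (suc k) p) ≡ suc k
    exact = trans (length-take (suc k) p) (m≤n⇒m⊓n≡m long)

witness : ∀ {P : Set} (d : Dec P) → does d ≡ true → P
witness (yes p) _ = p

-- Some bit vector of length s avoids any list of fewer than 2^s vectors:
-- split the list by first bit and recurse into the half that is short.
private
  tailsWithHead : ∀ {s} → Bool → List (BV (suc s)) → List (BV s)
  tailsWithHead b [] = []
  tailsWithHead false ((false ∷ v) ∷ B) = v ∷ tailsWithHead false B
  tailsWithHead false ((true ∷ v) ∷ B) = tailsWithHead false B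
  tailsWithHead true ((false ∷ v) ∷ B) = tailsWithHead true B
  tailsWithHead true ((true ∷ v) ∷ B) = v ∷ tailsWithHead true B

  length-tailsWithHead : ∀ {s} (B : List (BV (suc s))) →
                         length (tailsWithHead false B) + length (tailsWithHead true B) ≡ length B
  length-tailsWithHead [] = refl
  length-tailsWithHead ((false ∷ v) ∷ B) = cong suc (length-tailsWithHead B)
  length-tailsWithHead ((true ∷ v) ∷ B) = trans (+-suc _ _) (cong suc (length-tailsWithHead B))

  ∈-tailsWithHead : ∀ {s} b (v : BV s) (B : List (BV (suc s))) → (b ∷ v) ∈ B → v ∈ tailsWithHead b B
  ∈-tailsWithHead false v ((false ∷ w) ∷ B) (here refl) = here refl
  ∈-tailsWithHead true v ((true ∷ w) ∷ B) (here refl) = here refl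
  ∈-tailsWithHead false v ((false ∷ w) ∷ B) (there m) = there (∈-tailsWithHead false v B m)
  ∈-tailsWithHead false v ((true ∷ w) ∷ B) (there m) = ∈-tailsWithHead false v B m
  ∈-tailsWithHead true v ((false ∷ w) ∷ B) (there m) = ∈-tailsWithHead true v B m
  ∈-tailsWithHead true v ((true ∷ w) ∷ B) (there m) = there (∈-tailsWithHead true v B m)

fresh-vector : ∀ s (B : List (BV s)) → length B < 2 ^ s → Σ (BV s) (_∉ B)
fresh-vector zero [] _ = [] , λ ()
fresh-vector zero (_ ∷ _) (s≤s ())
fresh-vector (suc s) B short with length (tailsWithHead false B) <? 2 ^ s
... | yes short₀ = let (v , v∉) = fresh-vector s (tailsWithHead false B) short₀
                   in false ∷ v , v∉ ∘ ∈-tailsWithHead false v B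
... | no long₀ = let (v , v∉) = fresh-vector s (tailsWithHead true B) short₁
                 in true ∷ v , v∉ ∘ ∈-tailsWithHead true v B
  where
  short₁ : length (tailsWithHead true B) < 2 ^ s
  short₁ = +-cancelˡ-< (length (tailsWithHead false B)) _ _ (begin-strict
    length (tailsWithHead false B) + length (tailsWithHead true B) ≡⟨ length-tailsWithHead B ⟩
    length B                                                       <⟨ short ⟩
    2 ^ s + (2 ^ s + 0)                                            ≡⟨ cong (2 ^ s +_) (+-identityʳ _) ⟩
    2 ^ s + 2 ^ s                                                  ≤⟨ +-monoˡ-≤ (2 ^ s) (≮⇒≥ long₀) ⟩
    length (tailsWithHead false B) + 2 ^ s                         ∎)
    where open ≤-Reasoning

Independent : ∀ {N s} → ℕ → (Fin N → BV s) → Set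
Independent R c = ∀ D → size D ≤ R → sketch c D ≡ 𝟘 → ∀ i → D i ≡ false

-- Sparse recovery: under an R-independent code two sets of total size
-- ≤ R with equal sketches are equal (their symmetric difference has
-- sketch 𝟘).
sketch-determines : ∀ {N s R} {c : Fin N → BV s} → Independent R c → ∀ F H →
                    size F + size H ≤ R → sketch c F ≡ sketch c H → F ≗ H
sketch-determines {c = c} independent F H small same i =
  xor-false (F i) (H i) (independent (λ j → F j xor H j) (≤-trans (size-xor F H) small) zero-sketch i)
  where
  zero-sketch : sketch c (λ j → F j xor H j) ≡ 𝟘
  zero-sketch = trans (sketch-xor c F H) (trans (cong (_⊕ sketch c H) same) (⊕-self (sketch c H)))
  xor-false : ∀ a b → a xor b ≡ false → a ≡ b
  xor-false false false _ = refl
  xor-false true true _ = refl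

-- Greedy construction (Gilbert–Varshamov style): the codeword of a new
-- element only has to avoid the sketches of the ≤ (N+1)^R sets of at
-- most R old elements.
independent-code : ∀ s R N → suc N ^ R < 2 ^ s → Σ (Fin N → BV s) (Independent (suc R))
independent-code s R zero _ = (λ ()) , (λ D _ _ ())
independent-code s R (suc N) few = c′ , independent
  where
  few′ : suc N ^ R < 2 ^ s
  few′ = ≤-<-trans (^-monoˡ-≤ R (n≤1+n (suc N))) few
  old = independent-code s R N few′
  c = proj₁ old
  small = shortLists (allFin N) R
  forbidden = map (sketch c ∘ setOf) small
  forbidden-short : length forbidden < 2 ^ s
  forbidden-short = begin-strict
    length forbidden             ≡⟨ length-map (sketch c ∘ setOf) small ⟩
    length small                 ≤⟨ length-shortLists (allFin N) R ⟩
    suc (length (allFin N)) ^ R  ≡⟨ cong (λ m → suc m ^ R) (length-tabulate id) ⟩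
    suc N ^ R                    <⟨ few′ ⟩
    2 ^ s                        ∎
    where open ≤-Reasoning
  new = fresh-vector s forbidden forbidden-short
  c′ : Fin (suc N) → BV s
  c′ zero = proj₁ new
  c′ (suc i) = c i
  not-forbidden : ∀ D → size D ≤ R → proj₁ new ≢ sketch c D
  not-forbidden D small-D e = proj₂ new (subst (_∈ forbidden) (sym (trans e same)) (∈-map⁺ (sketch c ∘ setOf) listed))
    where
    same : sketch c D ≡ sketch c (setOf (trues D))
    same = ⊕Σ.sum-cong-≗ (λ i → cong (λ b → if b then c i else 𝟘) (sym (setOf-trues D i)))
    listed : trues D ∈ small
    listed = ∈-shortLists (allFin N) R (trues D) (all-allFin _) (≤-trans (≤-reflexive (length-trues D)) small-D)
  independent : Independent (suc R) c′
  independent D small-D zero-sketch with D zero in D0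
  ... | true = ⊥-elim (not-forbidden (D ∘ suc) (≤-pred small-D) (⊕-cancel _ _ zero-sketch))
  ... | false = λ { zero → D0
                  ; (suc i) → proj₂ old (D ∘ suc) small-D
                                (trans (sym (⊕-identityˡ _)) zero-sketch) i }

-- It maintains the
-- sketch of the flattened graph under a code that is independent for sets
-- of size ≤ 2B+1, B = 2k·n, together with the number of ordered adjacent
-- pairs (which never exceeds N = n·n).  If that number exceeds B the
-- graph has a k-path (path-or-sparse); otherwise the graph is recovered
-- from the sketch by exhaustive search and k-Path is decided on it.
module SketchAlgorithm (n k s : ℕ) (c : Fin (n * n) → BV s)
                       (independent : Independent (suc (2 * (n * (2 * k)))) c) where

  N B : ℕ
  N = n * n
  B = n * (2 * k)

  State : Set
  State = BV s × Fin (suc N)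

  -- counters are stored in Fin (suc N); values above N never occur
  cap : ℕ → Fin (suc N)
  cap x with x ≤? N
  ... | yes x≤N = fromℕ< (s≤s x≤N)
  ... | no _ = zero

  toℕ-cap : ∀ x → x ≤ N → toℕ (cap x) ≡ x
  toℕ-cap x x≤N with x ≤? N
  ... | yes _ = toℕ-fromℕ< _
  ... | no x≰N = ⊥-elim (x≰N x≤N)

  init : State
  init = 𝟘 , zero

  step : State → Update n → State
  step (S , m) (ins u v) = c (combine u v) ⊕ (c (combine v u) ⊕ S) , cap (2 + toℕ m)
  step (S , m) (del u v) = c (combine u v) ⊕ (c (combine v u) ⊕ S) , cap (toℕ m ∸ 2)

  candidate : List (Fin N) → Graph n
  candidate l x y = setOf l (combine x y)

  search : (S : BV s) → Dec (Any (λ l → S ≡ sketch c (setOf l) × HasPathOfLength≥ (candidate l) k)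
                                 (shortLists (allFin N) B))
  search S = Any.any? (λ l → ≡-dec Bool._≟_ S (sketch c (setOf l)) ×-dec hasPath? (candidate l) k)
                      (shortLists (allFin N) B)

  out : State → Bool
  out (S , m) with toℕ m ≤? B
  ... | yes _ = does (search S)
  ... | no _ = true

  Describes : Graph n → State → Set
  Describes G (S , m) = Sym G × S ≡ sketch c (flat G) × toℕ m ≡ size (flat G)

  describes-init : Describes emptyGraph init
  describes-init = (λ _ _ → refl) , sym (⊕Σ.sum-replicate-zero N) , sym (ℕΣ.sum-replicate-zero N)

  describes-ins : ∀ {G S m u v} → u ≢ v → G u v ≡ false → Describes G (S , m) →
                  Describes (setEdge true u v G) (step (S , m) (ins u v))
  describes-ins {G} {S} {m} {u} {v} u≢v absent (sym-G , sketched , counted) =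
    setEdge-sym true u v G sym-G ,
    trans (cong (λ z → c (combine u v) ⊕ (c (combine v u) ⊕ z)) sketched) (sym (⊕Σ.mask-insert₂ adds c)) ,
    trans (toℕ-cap _ (subst (_≤ N) (sym counted′) (size≤ _))) counted′
    where
    adds = insertion-adds u≢v sym-G absent
    counted′ : 2 + toℕ m ≡ size (flat (setEdge true u v G))
    counted′ = trans (cong (2 +_) counted) (sym (ℕΣ.mask-insert₂ adds (const 1)))

  -- a valid deletion removes it; xoring the same codewords again undoes them
  describes-del : ∀ {G S m u v} → u ≢ v → G u v ≡ true → Describes G (S , m) →
                  Describes (setEdge false u v G) (step (S , m) (del u v))
  describes-del {G} {S} {m} {u} {v} u≢v present (sym-G , sketched , counted) =
    setEdge-sym false u v G sym-G , sketched′ ,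
    trans (toℕ-cap _ (subst (_≤ N) (sym counted′) (size≤ _))) counted′
    where
    removes = deletion-removes u≢v sym-G present
    i = combine u v
    j = combine v u
    F′ = sketch c (flat (setEdge false u v G))
    sketched′ : c i ⊕ (c j ⊕ S) ≡ F′
    sketched′ = begin
      c i ⊕ (c j ⊕ S)                         ≡⟨ cong (λ z → c i ⊕ (c j ⊕ z)) (trans sketched (⊕Σ.mask-insert₂ removes c)) ⟩
      c i ⊕ (c j ⊕ (c i ⊕ (c j ⊕ F′)))        ≡⟨ ⊕-swap (c i) (c j) _ ⟩
      c j ⊕ (c i ⊕ (c i ⊕ (c j ⊕ F′)))        ≡⟨ cong (c j ⊕_) (⊕-cancelˡ (c i) _) ⟩
      c j ⊕ (c j ⊕ F′)                        ≡⟨ ⊕-cancelˡ (c j) F′ ⟩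
      F′                                      ∎
      where open ≡-Reasoning
    counted′ : toℕ m ∸ 2 ≡ size (flat (setEdge false u v G))
    counted′ = trans (cong (_∸ 2) (trans counted (ℕΣ.mask-insert₂ removes (const 1)))) (m+n∸m≡n 2 _)

  describes-run : ∀ G st σ → ValidFrom G σ → Describes G st →
                  Describes (foldl applyUpdate G σ) (foldl step st σ)
  describes-run G st [] _ d = d
  describes-run G (S , m) (ins u v ∷ σ) (u≢v , absent , valid) d =
    describes-run _ _ σ valid (describes-ins u≢v absent d)
  describes-run G (S , m) (del u v ∷ σ) (u≢v , present , valid) d =
    describes-run _ _ σ valid (describes-del u≢v present d)

  search-sound : ∀ {G S} → S ≡ sketch c (flat G) → size (flat G) ≤ B →
                 does (search S) ≡ true → HasPathOfLength≥ G k
  search-sound {G} {S} sketched sparse found with find (witness (search S) found)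
  ... | l , l∈ , matches , path = path-cong recovered path
    where
    small : size (flat G) + size (setOf l) ≤ suc (2 * B)
    small = begin
      size (flat G) + size (setOf l) ≤⟨ +-mono-≤ sparse (≤-trans (size-setOf l) (shortLists-length _ B l∈)) ⟩
      B + B                          ≡⟨ cong (B +_) (+-identityʳ B) ⟨
      2 * B                          ≤⟨ n≤1+n _ ⟩
      suc (2 * B)                    ∎
      where open ≤-Reasoning
    same : flat G ≗ setOf l
    same = sketch-determines independent (flat G) (setOf l) small (trans (sym sketched) matches)
    recovered : ∀ x y → candidate l x y ≡ G x y
    recovered x y = trans (sym (same (combine x y))) (flat-combine G x y)

  search-complete : ∀ {G S} → S ≡ sketch c (flat G) → size (flat G) ≤ B →
                    HasPathOfLength≥ G k → does (search S) ≡ true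
  search-complete {G} {S} sketched sparse path =
    dec-true (search S) (lose listed (matches , path-cong same path))
    where
    l = trues (flat G)
    listed : l ∈ shortLists (allFin N) B
    listed = ∈-shortLists (allFin N) B l (all-allFin l) (≤-trans (≤-reflexive (length-trues (flat G))) sparse)
    matches : S ≡ sketch c (setOf l)
    matches = trans sketched (⊕Σ.sum-cong-≗ (λ i → cong (λ b → if b then c i else 𝟘) (sym (setOf-trues (flat G) i))))
    same : ∀ x y → G x y ≡ candidate l x y
    same x y = trans (sym (flat-combine G x y)) (sym (setOf-trues (flat G) (combine x y)))

  correct : ∀ G st → Describes G st →
            (out st ≡ true → HasPathOfLength≥ G k) × (HasPathOfLength≥ G k → out st ≡ true)
  correct G (S , m) (sym-G , sketched , counted) with toℕ m ≤? B
  ... | yes m≤B = search-sound sketched sparse , search-complete sketched sparse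
    where sparse = subst (_≤ B) counted m≤B
  ... | no m≰B = (λ _ → dense-path) , (λ _ → refl)
    where
    dense-path : HasPathOfLength≥ G k
    dense-path with path-or-sparse G k sym-G
    ... | inj₁ path = path
    ... | inj₂ sparse = ⊥-elim (m≰B (subst (_≤ B) (trans (edgeCount-flat G) (sym counted)) sparse))

bits↪ : ∀ s → BV s ↪ Fin (2 ^ s)
bits↪ zero = mk↪ {to = const zero} {from = const []} (λ {x = x} _ → empty x)
  where
  empty : (v : BV 0) → [] ≡ v
  empty [] = refl
bits↪ (suc s) = ↔⇒↪ (↔-sym *↔×) ↪-∘ ((↔⇒↪ (↔-sym 2↔Bool) ×-↪ bits↪ s) ↪-∘ uncons)
  where
  uncons : BV (suc s) ↪ (Bool × BV s)
  uncons = mk↪ {to = λ { (b ∷ v) → b , v }} {from = λ (b , v) → b ∷ v} (λ { {b ∷ v} refl → refl })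

-- Fin M embeds in Fin b for M ≤ b; out-of-range codes decode to d
fin↪ : ∀ {M b} → Fin M → M ≤ b → Fin M ↪ Fin b
fin↪ {M} {b} d M≤b = mk↪ {to = λ x → inject≤ x M≤b} {from = from} (λ { {x} refl → back x })
  where
  from : Fin b → Fin M
  from y with toℕ y <? M
  ... | yes y<M = fromℕ< y<M
  ... | no _ = d
  back : ∀ x → from (inject≤ x M≤b) ≡ x
  back x with toℕ (inject≤ x M≤b) <? M
  ... | yes y<M = trans (fromℕ<-cong _ _ (toℕ-inject≤ x M≤b) y<M (toℕ<n x)) (fromℕ<-toℕ x (toℕ<n x))
  ... | no y≮M = ⊥-elim (y≮M (subst (_< M) (sym (toℕ-inject≤ x M≤b)) (toℕ<n x)))

module Simulation {A T : Set} (init : T) (step : T → A → T) (out : T → Bool)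
                  {b : ℕ} (embed : T ↪ Fin (2 ^ b)) where
  open RightInverse embed using (to; from; strictlyInverseʳ)

  algorithm : StreamAlg A b
  algorithm = record { init = to init ; step = λ x a → to (step (from x) a) ; out = out ∘ from }

  from-run : ∀ σ x → from (foldl (StreamAlg.step algorithm) x σ) ≡ foldl step (from x) σ
  from-run [] x = refl
  from-run (a ∷ σ) x = trans (from-run σ _) (cong (λ t → foldl step t σ) (strictlyInverseʳ _))

  out-run : ∀ σ → StreamAlg.out algorithm (StreamAlg.run algorithm σ) ≡ out (foldl step init σ)
  out-run σ = cong out (trans (from-run σ (to init)) (cong (λ t → foldl step t σ) (strictlyInverseʳ init)))

log-bound : ∀ n → n ≤ 2 ^ ⌈log₂ n ⌉
log-bound n = bound n _
  where
  bound : ∀ n (acc : Acc _<_ n) → n ≤ 2 ^ ⌈log2⌉ n acc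
  bound zero _ = z≤n
  bound (suc zero) _ = s≤s z≤n
  bound (suc (suc n)) (acc rs) = begin
    suc (suc n)                   ≤⟨ s≤s (s≤s (≤-trans (≤-reflexive (sym (⌊n/2⌋+⌈n/2⌉≡n n))) (+-monoˡ-≤ _ (⌊n/2⌋≤⌈n/2⌉ n)))) ⟩
    suc (suc (⌈ n /2⌉ + ⌈ n /2⌉))  ≡⟨ cong suc (+-suc _ _) ⟨
    suc ⌈ n /2⌉ + suc ⌈ n /2⌉      ≡⟨ cong (suc ⌈ n /2⌉ +_) (+-identityʳ _) ⟨
    2 * suc ⌈ n /2⌉                ≤⟨ *-monoʳ-≤ 2 (bound (suc ⌈ n /2⌉) _) ⟩
    2 * 2 ^ ⌈log2⌉ (suc ⌈ n /2⌉) _ ∎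
    where open ≤-Reasoning

pairs-fit : ∀ n → suc (n * n) ≤ 2 ^ (2 * wordBits n)
pairs-fit n = begin
  suc (n * n)                ≤⟨ s≤s (*-mono-≤ (log-bound n) (log-bound n)) ⟩
  suc (2 ^ L * 2 ^ L)        ≡⟨ cong suc (^-distribˡ-+-* 2 L L) ⟨
  suc (2 ^ (L + L))          ≤⟨ +-monoˡ-≤ (2 ^ (L + L)) (m^n>0 2 (L + L)) ⟩
  2 ^ (L + L) + 2 ^ (L + L)  ≡⟨ cong (2 ^ (L + L) +_) (+-identityʳ _) ⟨
  2 ^ suc (L + L)            ≤⟨ ^-monoʳ-≤ 2 (≤-trans (n≤1+n _) (≤-reflexive (double-suc L))) ⟩
  2 ^ (2 * wordBits n)       ∎
  where
  open ≤-Reasoning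
  L = ⌈log₂ n ⌉
  double-suc : ∀ L → suc (suc (L + L)) ≡ 2 * suc L
  double-suc = solve-∀

-- codewords of 1 + 2W·R bits leave room for an R-independent code on pairs
code-length-ok : ∀ n R → suc (n * n) ^ R < 2 ^ suc (2 * wordBits n * R)
code-length-ok n R = begin-strict
  suc (n * n) ^ R           ≤⟨ ^-monoˡ-≤ R (pairs-fit n) ⟩
  (2 ^ (2 * W)) ^ R         ≡⟨ ^-*-assoc 2 (2 * W) R ⟩
  2 ^ (2 * W * R)           <⟨ m<m+n (2 ^ (2 * W * R)) (subst (0 <_) (sym (+-identityʳ _)) (m^n>0 2 (2 * W * R))) ⟩
  2 ^ suc (2 * W * R)       ∎
  where
  open ≤-Reasoning
  W = wordBits n

-- the sketching state (code of length 1 + 2W·4kn, counter ≤ n²) fits in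
-- 11·kn·W bits when kn ≥ 1
state-fits : ∀ n k → 1 ≤ k * n →
             2 ^ suc (2 * wordBits n * (2 * (n * (2 * k)))) * suc (n * n) ≤ 2 ^ (11 * (k * n) * wordBits n)
state-fits n k kn≥1 = begin
  2 ^ s * suc (n * n)    ≤⟨ *-monoʳ-≤ (2 ^ s) (pairs-fit n) ⟩
  2 ^ s * 2 ^ (2 * W)    ≡⟨ ^-distribˡ-+-* 2 s (2 * W) ⟨
  2 ^ (s + 2 * W)        ≤⟨ ^-monoʳ-≤ 2 exponent ⟩
  2 ^ (11 * K * W)       ∎
  where
  open ≤-Reasoning
  W = wordBits n
  K = k * n
  s = suc (2 * W * (2 * (n * (2 * k))))
  W≤KW : W ≤ K * W
  W≤KW = ≤-trans (≤-reflexive (sym (*-identityˡ W))) (*-monoˡ-≤ W kn≥1)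
  rearrange : ∀ k n W → 2 * W * (2 * (n * (2 * k))) ≡ 8 * ((k * n) * W)
  rearrange = solve-∀
  collect : ∀ x → (x + 8 * x) + 2 * x ≡ 11 * x
  collect = solve-∀
  exponent : s + 2 * W ≤ 11 * K * W
  exponent = begin
    suc (2 * W * (2 * (n * (2 * k)))) + 2 * W  ≡⟨ cong (λ z → suc z + 2 * W) (rearrange k n W) ⟩
    suc (8 * (K * W)) + 2 * W                  ≤⟨ +-monoʳ-≤ (suc (8 * (K * W))) (*-monoʳ-≤ 2 W≤KW) ⟩
    suc (8 * (K * W)) + 2 * (K * W)            ≤⟨ +-monoˡ-≤ (2 * (K * W)) (+-monoˡ-≤ (8 * (K * W)) (≤-trans (s≤s z≤n) W≤KW)) ⟩
    (K * W + 8 * (K * W)) + 2 * (K * W)        ≡⟨ collect (K * W) ⟩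
    11 * (K * W)                               ≡⟨ *-assoc 11 K W ⟨
    11 * K * W                                 ∎

sketching-algorithm : ∀ n k → 1 ≤ k * n →
                      Σ (StreamAlg (Update n) (11 * (k * n) * wordBits n)) (DecidesPathInsDel k)
sketching-algorithm n k kn≥1 = Sim.algorithm , decides
  where
  R = 2 * (n * (2 * k))
  s = suc (2 * wordBits n * R)
  code = independent-code s R (n * n) (code-length-ok n R)
  open SketchAlgorithm n k s (proj₁ code) (proj₂ code)
  pack : State ↪ Fin (2 ^ s * suc N)
  pack = ↔⇒↪ (↔-sym *↔×) ↪-∘ (bits↪ s ×-↪ ↪-id (Fin (suc N)))
  module Sim = Simulation init step out {11 * (k * n) * wordBits n}
                          (fin↪ (RightInverse.to pack init) (state-fits n k kn≥1) ↪-∘ pack)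
  decides : DecidesPathInsDel k Sim.algorithm
  decides σ valid = subst (λ o → (o ≡ true → _) × (_ → o ≡ true)) (sym (Sim.out-run σ))
                          (correct (streamGraph σ) _ (describes-run emptyGraph init σ valid describes-init))

-- For k·n = 0 the answer does not depend on the graph: every graph has a
-- path of length 0 unless there are no vertices at all.
path-trivial : ∀ {n} {G H : Graph n} k → k * n ≡ 0 → HasPathOfLength≥ G k → HasPathOfLength≥ H k
path-trivial k kn≡0 ([] , _ , _ , ())
path-trivial k kn≡0 (x ∷ p , _) with m*n≡0⇒m≡0∨n≡0 k kn≡0
... | inj₁ refl = x ∷ [] , (All.[] ∷ []) , tt , s≤s z≤n
... | inj₂ refl with x
... | ()

constant-algorithm : ∀ n k b → k * n ≡ 0 → Σ (StreamAlg (Update n) b) (DecidesPathInsDel k)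
constant-algorithm n k b kn≡0 = Sim.algorithm , decides
  where
  answer = hasPath? emptyGraph k
  module Sim = Simulation tt (λ _ _ → tt) (λ _ → does answer) {b}
                          (mk↪ {to = const (fromℕ< (m^n>0 2 b))} {from = const tt} (λ _ → refl))
  decides : DecidesPathInsDel k Sim.algorithm
  decides σ _ = (λ accepted → path-trivial k kn≡0 (witness answer accepted))
              , (λ path → dec-true answer (path-trivial k kn≡0 path))

insertion-deletion-algorithm : ∀ n k → Σ (StreamAlg (Update n) (11 * (k * n) * wordBits n)) (DecidesPathInsDel k)
insertion-deletion-algorithm n k with k * n ℕ.≟ 0
... | yes kn≡0 = constant-algorithm n k _ kn≡0
... | no kn≢0 = sketching-algorithm n k (n≢0⇒n>0 kn≢0)

insertion-only : ∀ {n k b} → Σ (StreamAlg (Update n) b) (DecidesPathInsDel k) →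
                 Σ (StreamAlg (Fin n × Fin n) b) (DecidesPathIns k)
insertion-only {n} {k} (A , decides) = A′ , λ σ valid →
  subst (λ x → (StreamAlg.out A x ≡ true → _) × (_ → StreamAlg.out A x ≡ true))
        (foldl-map (StreamAlg.step A) _ (StreamAlg.init A) σ) (decides (insStream σ) valid)
  where
  A′ : StreamAlg (Fin n × Fin n) _
  A′ = record { init = StreamAlg.init A
              ; step = λ x e → StreamAlg.step A x (ins (proj₁ e) (proj₂ e))
              ; out = StreamAlg.out A }

theorem22 : (Σ ℕ λ C → (n k : ℕ) →
               Σ (StreamAlg (Fin n × Fin n) (C * (k * n) * wordBits n)) λ A →
                 DecidesPathIns k A)
            ×
            (Σ ℕ λ C → Σ ℕ λ c → (n k : ℕ) →
               Σ (StreamAlg (Update n) (C * (k * n) * (wordBits n ^ c))) λ A →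
                 DecidesPathInsDel k A)
theorem22 =
  (11 , λ n k → insertion-only (insertion-deletion-algorithm n k)) ,
  (11 , 1 , λ n k → subst (λ b → Σ (StreamAlg (Update n) b) (DecidesPathInsDel k))
                          (cong (11 * (k * n) *_) (sym (*-identityʳ (wordBits n))))
                          (insertion-deletion-algorithm n k))
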